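{- Let $n$ be a positive integer with $n\equiv1\pmod6$ satisfying one of: (a) $n\equiv0\pmod5$; (b) $n\ge186$, $n\equiv1\pmod5$; (c) $n\ge125$, $n\equiv2\pmod5$; (d) $n\equiv3\pmod5$; (e) $n\ge83$, $n\equiv4\pmod5$. Let $H$ be any abelian group of order $n^2+n+1$. Then there are no inverse-closed subsets $T_0,T_1\subseteq H$ with $e\in T_0$ satisfying $T_0T_1=H-e$ and $T_0^2+T_1^2=2H-T_0^{(2)}-T_1^{(2)}+2ne$ in $\mathbb{Z}[H]$.
   Context: $H$ is written multiplicatively with identity $e$; $\mathbb{Z}[H]$ is the integral group ring, a subset $D\subseteq H$ is identified with $\sum_{g\in D}g$, and $H$ also denotes $\sum_{h\in H}h$. For $A=\sum a_gg$ and $t\in\mathbb{Z}$, $A^{(t)}=\sum a_gg^t$. Inverse-closed means $T^{(-1)}=T$. -}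

module Defs where

open import Data.Nat as ℕ using (ℕ; zero; suc; _%_; _≥_)
open import Data.Fin using (Fin; zero; suc; _≟_)
open import Data.Bool using (Bool; true; false)
open import Data.Integer as ℤ using (ℤ; +_; _+_; _-_; _*_)
open import Data.Sum using (_⊎_)
open import Data.Product using (_×_)
open import Relation.Nullary.Decidable using (does)
open import Relation.Binary.PropositionalEquality using (_≡_)
open import Algebra.Structures using (IsAbelianGroup)
open import Level using (0ℓ)

-- A finite abelian group of order N, given concretely on the carrier Fin N
-- (every abelian group of order N is isomorphic to one of these).
record FinAbGroup (N : ℕ) : Set where
  field
    _∙_   : Fin N → Fin N → Fin N
    ε     : Fin N
    _⁻¹   : Fin N → Fin N
    isAbelianGroup : IsAbelianGroup _≡_ _∙_ ε _⁻¹

Σℤ : {N : ℕ} → (Fin N → ℤ) → ℤ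
Σℤ {zero}  f = + 0
Σℤ {suc N} f = f zero + Σℤ {N} (λ i → f (suc i))

GroupRing : ℕ → Set
GroupRing N = Fin N → ℤ

Subset : ℕ → Set
Subset N = Fin N → Bool

χ : Bool → ℤ
χ true  = + 1
χ false = + 0

module _ {N : ℕ} (G : FinAbGroup N) where
  open FinAbGroup G

  ⟦_⟧ : Subset N → GroupRing N
  ⟦ D ⟧ g = χ (D g)

  𝟙H : GroupRing N
  𝟙H g = + 1

  𝟙e : GroupRing N
  𝟙e g = χ (does (g ≟ ε))

  _⊛_ : GroupRing N → GroupRing N → GroupRing N
  (A ⊛ B) g = Σℤ (λ h → A h * B ((h ⁻¹) ∙ g))

  _⁽²⁾ : GroupRing N → GroupRing N
  (A ⁽²⁾) g = Σℤ (λ h → A h * χ (does ((h ∙ h) ≟ g)))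

  InverseClosed : Subset N → Set
  InverseClosed T = ∀ g → T (g ⁻¹) ≡ T g

_⊕_ : {N : ℕ} → GroupRing N → GroupRing N → GroupRing N
(A ⊕ B) g = A g + B g

_⊖_ : {N : ℕ} → GroupRing N → GroupRing N → GroupRing N
(A ⊖ B) g = A g - B g

_·_ : {N : ℕ} → ℤ → GroupRing N → GroupRing N
(k · A) g = k * A g

Hyp : ℕ → Set
Hyp n = (n % 6 ≡ 1) ×
        ( (n % 5 ≡ 0)
        ⊎ (n ≥ 186 × n % 5 ≡ 1)
        ⊎ (n ≥ 125 × n % 5 ≡ 2)
        ⊎ (n % 5 ≡ 3)
        ⊎ (n ≥ 83 × n % 5 ≡ 4))

-- Since n ≡ 1 (mod 3), the order n² + n + 1 of H is 3 M with M ≡ 1 (mod 3).  Cauchy's theorem for the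
-- prime 3 and Lagrange's theorem show that the cube roots of e form a cyclic group ⟨x⟩ of order 3, and
-- h ↦ h ^ M maps H onto it; this gives a homomorphism φ of H onto ℤ/3, hence a character ω ^ φ of order 3.
-- Its real part D is multiplicative on inverse-closed elements of ℤ[H], satisfies D(H) = 0 and D(e) = 1,
-- and does not see A ↦ A⁽²⁾ on inverse-closed A.  For X = D(T₀) and Y = D(T₁) the two equations become
-- X Y = -1 and X² + Y² = 2n - X - Y, so X + Y = 0, X² + Y² = 2 and n = 1, which the hypotheses exclude.
module Submission where

open import Defs
open import Algebra.Bundles using (AbelianGroup)
import Algebra.Properties.AbelianGroup as AbelianGroupProperties
import Algebra.Properties.CommutativeMonoid.Mult as CommutativeMonoidMult
import Algebra.Properties.CommutativeMonoid.Sum as CommutativeMonoidSum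
import Algebra.Properties.CommutativeSemigroup as CommutativeSemigroupProperties
open import Data.Bool using (true)
open import Data.Empty using (⊥-elim)
open import Data.Fin as Fin using (Fin; zero; suc; toℕ; _≟_)
open import Data.Fin.Patterns using (0F; 1F; 2F)
open import Data.Fin.Permutation using (permutation)
import Data.Fin.Properties as FinP
open import Data.Integer as ℤ using (ℤ; +_; +0; +[1+_]; -[1+_]; -_; _+_; _-_; _*_)
import Data.Integer.Properties as ℤP
open import Data.Integer.Tactic.RingSolver using (solve-∀)
open import Data.Nat as ℕ using (ℕ; zero; suc; _≥_; _%_)
open import Data.Nat.DivMod using (_mod_; _/_; m≡m%n+[m/n]*n; m%n<n; [m+kn]%n≡m%n; m∣n⇒o%n%m≡o%m)
open import Data.Nat.Divisibility using (_∣_; divides; ∣m⇒∣m*n; *-cancelˡ-∣; n∣m⇒m%n≡0)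
import Data.Nat.Properties as ℕP
import Data.Nat.Tactic.RingSolver as ℕ-Solver
open import Data.Product using (_×_; _,_; proj₁; proj₂; ∃; ∃-syntax; uncurry)
open import Data.Sum using (_⊎_; inj₁; inj₂)
open import Function using (_∘_; _⇔_; mk⇔; Injective)
open import Level using (0ℓ)
open import Relation.Binary.Core using (Rel)
open import Relation.Binary.PropositionalEquality
open import Relation.Binary.Structures using (IsDecEquivalence)
open import Relation.Nullary using (¬_; Dec; yes; no; does; _×-dec_; _→-dec_; ¬?)
open import Relation.Nullary.Decidable using (does-⇔; decidable-stable)
open import Relation.Unary using (Pred; Decidable)

open import Algebra.Properties.Semiring.Sum ℤP.+-*-semiring
  using (sum; sum-cong-≗; sum-remove; sum-replicate-zero; ∑-comm; ∑-distrib-+;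
         sum-permute; *-distribˡ-sum; *-distribʳ-sum)

open ≡-Reasoning

-- Finite sums and indicators

ind : ∀ {a} {A : Set a} → Dec A → ℤ
ind a? = χ (does a?)

δ : ∀ {K} → Fin K → Fin K → ℤ
δ i j = ind (i ≟ j)

Σℤ≡sum : ∀ {K} (f : Fin K → ℤ) → Σℤ f ≡ sum f
Σℤ≡sum {zero}  f = refl
Σℤ≡sum {suc K} f = cong (λ s → f zero + s) (Σℤ≡sum (f ∘ suc))

sum-const : ∀ K (c : ℤ) → sum {K} (λ _ → c) ≡ + K * c
sum-const zero    c = sym (ℤP.*-zeroˡ c)
sum-const (suc K) c = begin
  c + sum {K} (λ _ → c)  ≡⟨ cong (λ s → c + s) (sum-const K c) ⟩
  c + + K * c            ≡⟨ sym (ℤP.suc-* (+ K) c) ⟩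
  ℤ.suc (+ K) * c        ∎

sum-reindex : ∀ {K} (π π⁻¹ : Fin K → Fin K) →
              (∀ i → π (π⁻¹ i) ≡ i) → (∀ i → π⁻¹ (π i) ≡ i) →
              (f : Fin K → ℤ) → sum (f ∘ π) ≡ sum f
sum-reindex π π⁻¹ π∘π⁻¹ π⁻¹∘π f = sym (sum-permute f (permutation π π⁻¹ π∘π⁻¹ π⁻¹∘π))

sum-neg : ∀ {K} (f : Fin K → ℤ) → sum (λ i → - f i) ≡ - sum f
sum-neg f = begin
  sum (λ i → - f i)        ≡⟨ sum-cong-≗ (λ i → sym (ℤP.-1*i≡-i (f i))) ⟩
  sum (λ i → - + 1 * f i)  ≡⟨ sym (*-distribˡ-sum (- + 1) f) ⟩
  - + 1 * sum f            ≡⟨ ℤP.-1*i≡-i (sum f) ⟩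
  - sum f                  ∎

sum-δ : ∀ {K} (f : Fin K → ℤ) (a : Fin K) → sum (λ i → f i * δ i a) ≡ f a
sum-δ {suc K} f a = begin
  sum (λ i → f i * δ i a)                    ≡⟨ sum-remove {i = a} (λ i → f i * δ i a) ⟩
  f a * δ a a + sum (λ j → f (a⁺ j) * δ (a⁺ j) a)  ≡⟨ cong₂ _+_ on-diagonal off-diagonal ⟩
  f a + + 0                                  ≡⟨ ℤP.+-identityʳ (f a) ⟩
  f a                                        ∎
  where
  a⁺ : Fin K → Fin (suc K)
  a⁺ = Fin.punchIn a
  on-diagonal : f a * δ a a ≡ f a
  on-diagonal with a ≟ a
  ... | yes _   = ℤP.*-identityʳ (f a)
  ... | no  a≢a = ⊥-elim (a≢a refl)
  vanishes : ∀ j → f (a⁺ j) * δ (a⁺ j) a ≡ + 0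
  vanishes j with a⁺ j ≟ a
  ... | yes a⁺j≡a = ⊥-elim (FinP.punchInᵢ≢i a j a⁺j≡a)
  ... | no  _     = ℤP.*-zeroʳ (f (a⁺ j))
  off-diagonal : sum (λ j → f (a⁺ j) * δ (a⁺ j) a) ≡ + 0
  off-diagonal = trans (sum-cong-≗ vanishes) (sum-replicate-zero K)

ind-⇔ : ∀ {A B : Set} → A ⇔ B → (a? : Dec A) (b? : Dec B) → ind a? ≡ ind b?
ind-⇔ A⇔B a? b? = cong χ (does-⇔ A⇔B a? b?)

ind-× : ∀ {A B : Set} (a? : Dec A) (b? : Dec B) → ind (a? ×-dec b?) ≡ ind a? * ind b?
ind-× (yes _) (yes _) = refl
ind-× (yes _) (no  _) = refl
ind-× (no  _) (yes _) = refl
ind-× (no  _) (no  _) = refl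

δ-sym : ∀ {K} (i j : Fin K) → δ i j ≡ δ j i
δ-sym i j = ind-⇔ (mk⇔ sym sym) (i ≟ j) (j ≟ i)

module _ {K} {P : Pred (Fin K) 0ℓ} (P? : Decidable P) where

  sum-ind-unique : ∀ {a} → P a → (∀ {i} → P i → i ≡ a) → sum (λ i → ind (P? i)) ≡ + 1
  sum-ind-unique {a} Pa unique = begin
    sum (λ i → ind (P? i))   ≡⟨ sum-cong-≗ ind≡δ ⟩
    sum (λ i → + 1 * δ i a)  ≡⟨ sum-δ (λ _ → + 1) a ⟩
    + 1                      ∎
    where
    P⇔≡a : ∀ {i} → P i ⇔ (i ≡ a)
    P⇔≡a = mk⇔ unique (λ i≡a → subst P (sym i≡a) Pa)
    ind≡δ : ∀ i → ind (P? i) ≡ + 1 * δ i a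
    ind≡δ i = trans (ind-⇔ P⇔≡a (P? i) (i ≟ a)) (sym (ℤP.*-identityˡ (δ i a)))

  sum-ind-none : (∀ i → ¬ P i) → sum (λ i → ind (P? i)) ≡ + 0
  sum-ind-none ∄P = trans (sum-cong-≗ ind≡0) (sum-replicate-zero K)
    where
    ind≡0 : ∀ i → ind (P? i) ≡ + 0
    ind≡0 i with P? i
    ... | yes Pi = ⊥-elim (∄P i Pi)
    ... | no  _  = refl

module _ {k K} (ι : Fin k → Fin K) where

  InImage : Pred (Fin K) 0ℓ
  InImage h = ∃[ t ] ι t ≡ h

  inImage? : Decidable InImage
  inImage? h = FinP.any? (λ t → ι t ≟ h)

  sum-image : Injective _≡_ _≡_ ι → sum (λ h → ind (inImage? h)) ≡ + k
  sum-image ι-injective = begin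
    sum (λ h → ind (inImage? h))       ≡⟨ sum-cong-≗ count-preimages ⟩
    sum (λ h → sum (λ t → δ (ι t) h))  ≡⟨ ∑-comm (λ h t → δ (ι t) h) ⟩
    sum (λ t → sum (λ h → δ (ι t) h))  ≡⟨ sum-cong-≗ (λ t → sum-ind-unique (ι t ≟_) refl sym) ⟩
    sum {k} (λ _ → + 1)                ≡⟨ trans (sum-const k (+ 1)) (ℤP.*-identityʳ (+ k)) ⟩
    + k                                ∎
    where
    count-preimages : ∀ h → ind (inImage? h) ≡ sum (λ t → δ (ι t) h)
    count-preimages h with inImage? h
    ... | yes (t₀ , ιt₀≡h) =
      sym (sum-ind-unique (λ t → ι t ≟ h) ιt₀≡h (λ ιt≡h → ι-injective (trans ιt≡h (sym ιt₀≡h))))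
    ... | no ∄t = sym (sum-ind-none (λ t → ι t ≟ h) (λ t ιt≡h → ∄t (t , ιt≡h)))

self-neg⇒0 : ∀ {a} → a ≡ - a → a ≡ + 0
self-neg⇒0 {+0}        _  = refl
self-neg⇒0 {+[1+ _ ]}  ()
self-neg⇒0 { -[1+ _ ]} ()

multiple-of-3≢1+3* : ∀ {m} w → 3 ∣ m → + m ≢ + 1 + + 3 * w
multiple-of-3≢1+3* {m} w (divides c m≡c*3) m≡1+3w = 3≢1 (ℕP.m*n≡1⇒m≡1 3 ℤ.∣ + c - w ∣ (begin
  3 ℕ.* ℤ.∣ + c - w ∣    ≡⟨ sym (ℤP.abs-* (+ 3) (+ c - w)) ⟩
  ℤ.∣ + 3 * (+ c - w) ∣  ≡⟨ cong ℤ.∣_∣ 3[c-w]≡1 ⟩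
  1                      ∎))
  where
  3≢1 : 3 ≢ 1
  3≢1 ()
  distrib : ∀ a b → + 3 * (a - b) ≡ + 3 * a - + 3 * b
  distrib = solve-∀
  cancel : ∀ a b → a + b - b ≡ a
  cancel = solve-∀
  3[c-w]≡1 : + 3 * (+ c - w) ≡ + 1
  3[c-w]≡1 = begin
    + 3 * (+ c - w)          ≡⟨ distrib (+ c) w ⟩
    + 3 * + c - + 3 * w      ≡⟨ cong (_- + 3 * w) (trans (sym (ℤP.pos-* 3 c)) (cong +_ 3c≡m)) ⟩
    + m - + 3 * w            ≡⟨ cong (_- + 3 * w) m≡1+3w ⟩
    + 1 + + 3 * w - + 3 * w  ≡⟨ cancel (+ 1) (+ 3 * w) ⟩
    + 1                      ∎
    where
    3c≡m : 3 ℕ.* c ≡ m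
    3c≡m = trans (ℕP.*-comm 3 c) (sym m≡c*3)

-- Counting by equivalence classes

module _ {K} {P : Pred (Fin K) 0ℓ} (P? : Decidable P) where

  IsLeast : Pred (Fin K) 0ℓ
  IsLeast q = P q × (∀ r → P r → q Fin.≤ r)

  isLeast? : Decidable IsLeast
  isLeast? q = P? q ×-dec FinP.all? (λ r → P? r →-dec (q FinP.≤? r))

  least-unique : ∀ {q q′} → IsLeast q → IsLeast q′ → q ≡ q′
  least-unique (Pq , q≤) (Pq′ , q′≤) = FinP.≤-antisym (q≤ _ Pq′) (q′≤ _ Pq)

  least-exists : ∀ {p} → P p → ∃ IsLeast
  least-exists {p} Pp with FinP.¬∀⟶∃¬-smallest K (¬_ ∘ P) (¬? ∘ P?) (λ ∀¬P → ∀¬P p Pp)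
  ... | q , ¬¬Pq , ¬P-below = q , decidable-stable (P? q) ¬¬Pq , q≤
    where
    inject-fromℕ< : ∀ {r} (r<q : toℕ r ℕ.< toℕ q) → Fin.inject (Fin.fromℕ< r<q) ≡ r
    inject-fromℕ< r<q = FinP.toℕ-injective (trans (FinP.toℕ-inject _) (FinP.toℕ-fromℕ< r<q))
    q≤ : ∀ r → P r → q Fin.≤ r
    q≤ r Pr = ℕP.≮⇒≥ (λ r<q → ¬P-below (Fin.fromℕ< r<q) (subst P (sym (inject-fromℕ< r<q)) Pr))

  sum-isLeast : ∀ {p} → P p → sum (λ q → ind (isLeast? q)) ≡ + 1
  sum-isLeast Pp with least-exists Pp
  ... | q , least = sum-ind-unique isLeast? least (λ least′ → least-unique least′ least)

module ClassCounting {K} {_~_ : Rel (Fin K) 0ℓ} (~-isDecEquivalence : IsDecEquivalence _~_) where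
  open IsDecEquivalence ~-isDecEquivalence
    using () renaming (_≟_ to _~?_; refl to ~-refl; sym to ~-sym; trans to ~-trans)

  IsLeastOfClass : Pred (Fin K) 0ℓ
  IsLeastOfClass q = ∀ r → q ~ r → q Fin.≤ r

  leastOfClass? : Decidable IsLeastOfClass
  leastOfClass? q = FinP.all? (λ r → (q ~? r) →-dec (q FinP.≤? r))

  classSize : Fin K → ℤ
  classSize q = sum (λ p → ind (q ~? p))

  isLeast⇔isLeastOfClass×~ : ∀ {p q} → IsLeast (p ~?_) q ⇔ (IsLeastOfClass q × q ~ p)
  isLeast⇔isLeastOfClass×~ = mk⇔
    (λ (p~q , least) → (λ r q~r → least r (~-trans p~q q~r)) , ~-sym p~q)
    (λ (least , q~p) → ~-sym q~p , (λ r p~r → least r (~-trans q~p p~r)))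

  -- Every element is counted once, at the least element of its class.
  count-by-classes : + K ≡ sum (λ q → ind (leastOfClass? q) * classSize q)
  count-by-classes = begin
    + K
      ≡⟨ sym (trans (sum-const K (+ 1)) (ℤP.*-identityʳ (+ K))) ⟩
    sum {K} (λ _ → + 1)
      ≡⟨ sum-cong-≗ (λ p → sym (sum-isLeast (p ~?_) ~-refl)) ⟩
    sum (λ p → sum (λ q → ind (isLeast? (p ~?_) q)))
      ≡⟨ sum-cong-≗ (λ p → sum-cong-≗ (split-indicator p)) ⟩
    sum (λ p → sum (λ q → ind (leastOfClass? q) * ind (q ~? p)))
      ≡⟨ ∑-comm (λ p q → ind (leastOfClass? q) * ind (q ~? p)) ⟩
    sum (λ q → sum (λ p → ind (leastOfClass? q) * ind (q ~? p)))
      ≡⟨ sum-cong-≗ (λ q → sym (*-distribˡ-sum (ind (leastOfClass? q)) (λ p → ind (q ~? p)))) ⟩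
    sum (λ q → ind (leastOfClass? q) * classSize q)
      ∎
    where
    split-indicator : ∀ p q → ind (isLeast? (p ~?_) q) ≡ ind (leastOfClass? q) * ind (q ~? p)
    split-indicator p q =
      trans (ind-⇔ isLeast⇔isLeastOfClass×~ (isLeast? (p ~?_) q) (leastOfClass? q ×-dec (q ~? p)))
            (ind-× (leastOfClass? q) (q ~? p))

-- The group ℤ/3 and permutations of order 3

infixl 6 _+₃_
infix  8 -₃_

_+₃_ : Fin 3 → Fin 3 → Fin 3
i +₃ j = (toℕ i ℕ.+ toℕ j) mod 3

-₃_ : Fin 3 → Fin 3
-₃ 0F = 0F
-₃ 1F = 2F
-₃ 2F = 1F

+₃-inverseʳ : ∀ i → i +₃ -₃ i ≡ 0F
+₃-inverseʳ 0F = refl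
+₃-inverseʳ 1F = refl
+₃-inverseʳ 2F = refl

+₃-idem⇒0 : ∀ i → i +₃ i ≡ i → i ≡ 0F
+₃-idem⇒0 0F _ = refl
+₃-idem⇒0 1F ()
+₃-idem⇒0 2F ()

+₃-inverse-unique : ∀ i j → i +₃ j ≡ 0F → j ≡ -₃ i
+₃-inverse-unique 0F 0F _ = refl
+₃-inverse-unique 1F 2F _ = refl
+₃-inverse-unique 2F 1F _ = refl
+₃-inverse-unique 0F 1F ()
+₃-inverse-unique 0F 2F ()
+₃-inverse-unique 1F 0F ()
+₃-inverse-unique 1F 1F ()
+₃-inverse-unique 2F 0F ()
+₃-inverse-unique 2F 2F ()

+₃-cancel : ∀ i j → i +₃ -₃ j ≡ 0F → i ≡ j
+₃-cancel 0F 0F _ = refl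
+₃-cancel 1F 1F _ = refl
+₃-cancel 2F 2F _ = refl
+₃-cancel 0F 1F ()
+₃-cancel 0F 2F ()
+₃-cancel 1F 0F ()
+₃-cancel 1F 2F ()
+₃-cancel 2F 0F ()
+₃-cancel 2F 1F ()

module OrderThreePermutation {K} (σ : Fin K → Fin K) (σ³≡id : ∀ p → σ (σ (σ p)) ≡ p) where

  orbit : Fin K → Fin 3 → Fin K
  orbit p 0F = p
  orbit p 1F = σ p
  orbit p 2F = σ (σ p)

  orbit-+ : ∀ p i j → orbit (orbit p i) j ≡ orbit p (i +₃ j)
  orbit-+ p 0F 0F = refl
  orbit-+ p 0F 1F = refl
  orbit-+ p 0F 2F = refl
  orbit-+ p 1F 0F = refl
  orbit-+ p 1F 1F = refl
  orbit-+ p 1F 2F = σ³≡id p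
  orbit-+ p 2F 0F = refl
  orbit-+ p 2F 1F = σ³≡id p
  orbit-+ p 2F 2F = σ³≡id (σ p)

  orbit-fixed : ∀ {p} → σ p ≡ p → ∀ i → orbit p i ≡ p
  orbit-fixed σp≡p 0F = refl
  orbit-fixed σp≡p 1F = σp≡p
  orbit-fixed σp≡p 2F = trans (cong σ σp≡p) σp≡p

  module _ {p} (σp≢p : σ p ≢ p) where

    orbit-kernel : ∀ d → orbit p d ≡ p → d ≡ 0F
    orbit-kernel 0F _     = refl
    orbit-kernel 1F σp≡p  = ⊥-elim (σp≢p σp≡p)
    orbit-kernel 2F σσp≡p = ⊥-elim (σp≢p (trans (cong σ (sym σσp≡p)) (σ³≡id p)))

    orbit-injective : Injective _≡_ _≡_ (orbit p)
    orbit-injective {i} {j} eq = +₃-cancel i j (orbit-kernel (i +₃ -₃ j) (begin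
      orbit p (i +₃ -₃ j)       ≡⟨ sym (orbit-+ p i (-₃ j)) ⟩
      orbit (orbit p i) (-₃ j)  ≡⟨ cong (λ q → orbit q (-₃ j)) eq ⟩
      orbit (orbit p j) (-₃ j)  ≡⟨ orbit-+ p j (-₃ j) ⟩
      orbit p (j +₃ -₃ j)       ≡⟨ cong (orbit p) (+₃-inverseʳ j) ⟩
      p                         ∎))

  _~_ : Rel (Fin K) 0ℓ
  p ~ q = InImage (orbit p) q

  ~-sym : ∀ {p q} → p ~ q → q ~ p
  ~-sym {p} (i , refl) = -₃ i , trans (orbit-+ p i (-₃ i)) (cong (orbit p) (+₃-inverseʳ i))

  ~-trans : ∀ {p q r} → p ~ q → q ~ r → p ~ r
  ~-trans {p} (i , refl) (j , refl) = i +₃ j , sym (orbit-+ p i j)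

  ~-isDecEquivalence : IsDecEquivalence _~_
  ~-isDecEquivalence = record
    { isEquivalence = record { refl = 0F , refl ; sym = ~-sym ; trans = ~-trans }
    ; _≟_           = λ p → inImage? (orbit p)
    }

  open ClassCounting ~-isDecEquivalence

  fixed⇒isLeastOfClass : ∀ {q} → σ q ≡ q → IsLeastOfClass q
  fixed⇒isLeastOfClass σq≡q r (i , eq) = FinP.≤-reflexive (trans (sym (orbit-fixed σq≡q i)) eq)

  orbitSize-fixed : ∀ {q} → σ q ≡ q → classSize q ≡ + 1
  orbitSize-fixed σq≡q = sum-ind-unique (inImage? (orbit _)) (0F , refl)
                           (λ (i , eq) → trans (sym eq) (orbit-fixed σq≡q i))

  orbitSize-free : ∀ {q} → σ q ≢ q → classSize q ≡ + 3
  orbitSize-free σq≢q = sum-image (orbit _) (orbit-injective σq≢q)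

  size≡fixed+3* : ∃[ W ] + K ≡ sum (λ q → ind (σ q ≟ q)) + + 3 * W
  size≡fixed+3* = sum leastOfFreeOrbit , (begin
    + K
      ≡⟨ count-by-classes ⟩
    sum (λ q → ind (leastOfClass? q) * classSize q)
      ≡⟨ sum-cong-≗ weight ⟩
    sum (λ q → ind (σ q ≟ q) + + 3 * leastOfFreeOrbit q)
      ≡⟨ ∑-distrib-+ (λ q → ind (σ q ≟ q)) (λ q → + 3 * leastOfFreeOrbit q) ⟩
    sum (λ q → ind (σ q ≟ q)) + sum (λ q → + 3 * leastOfFreeOrbit q)
      ≡⟨ cong (λ s → sum (λ q → ind (σ q ≟ q)) + s) (sym (*-distribˡ-sum (+ 3) leastOfFreeOrbit)) ⟩
    sum (λ q → ind (σ q ≟ q)) + + 3 * sum leastOfFreeOrbit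
      ∎)
    where
    leastOfFreeOrbit : Fin K → ℤ
    leastOfFreeOrbit q = ind (leastOfClass? q ×-dec ¬? (σ q ≟ q))

    weigh : ∀ {A B : Set} (a? : Dec A) (b? : Dec B) {c : ℤ} →
            (B → A) → (B → c ≡ + 1) → (¬ B → c ≡ + 3) → ind a? * c ≡ ind b? + + 3 * ind (a? ×-dec ¬? b?)
    weigh (yes _) (yes b) _   c≡1 _   = cong (+ 1 *_) (c≡1 b)
    weigh (no ¬a) (yes b) b⇒a _   _   = ⊥-elim (¬a (b⇒a b))
    weigh (yes _) (no ¬b) _   _   c≡3 = cong (+ 1 *_) (c≡3 ¬b)
    weigh (no _)  (no _) {c} _ _ _    = ℤP.*-zeroˡ c

    weight : ∀ q → ind (leastOfClass? q) * classSize q ≡ ind (σ q ≟ q) + + 3 * leastOfFreeOrbit q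
    weight q = weigh (leastOfClass? q) (σ q ≟ q) fixed⇒isLeastOfClass orbitSize-fixed orbitSize-free

-- Finite abelian groups

module FinAbGroupProperties {N} (G : FinAbGroup N) where
  open FinAbGroup G public renaming (_∙_ to infixl 7 _∙_; _⁻¹ to infix 8 _⁻¹)

  abelianGroup : AbelianGroup 0ℓ 0ℓ
  abelianGroup = record { isAbelianGroup = isAbelianGroup }

  open AbelianGroup abelianGroup public
    using (assoc; comm; identityˡ; identityʳ; inverseʳ)
  open AbelianGroupProperties abelianGroup public
    using (⁻¹-involutive; ⁻¹-anti-homo-∙; ⁻¹-∙-comm; \\-leftDividesˡ; \\-leftDividesʳ; //-rightDividesʳ;
           ∙-cancelˡ; inverseʳ-unique; identityˡ-unique; ε⁻¹≈ε)
  open AbelianGroup abelianGroup using (commutativeMonoid; commutativeSemigroup)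
  open CommutativeSemigroupProperties commutativeSemigroup using (interchange)
  open CommutativeMonoidMult commutativeMonoid
    using (×-homo-+; ×-assocˡ; ×-distrib-+) renaming (_×_ to _times_)
  module ∏ = CommutativeMonoidSum commutativeMonoid

  infixr 8 _^_ _^₃_

  _^_ : Fin N → ℕ → Fin N
  x ^ m = m times x

  _^₃_ : Fin N → Fin 3 → Fin N
  x ^₃ i = x ^ toℕ i

  ^-+ : ∀ x m k → x ^ (m ℕ.+ k) ≡ x ^ m ∙ x ^ k
  ^-+ = ×-homo-+

  ^-* : ∀ x m k → (x ^ k) ^ m ≡ x ^ (m ℕ.* k)
  ^-* = ×-assocˡ

  ^-∙ : ∀ x y m → (x ∙ y) ^ m ≡ x ^ m ∙ y ^ m
  ^-∙ = ×-distrib-+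

  ε^ : ∀ m → ε ^ m ≡ ε
  ε^ zero    = refl
  ε^ (suc m) = trans (identityˡ (ε ^ m)) (ε^ m)

  -- Multiplying all elements of G by x permutes them.
  ^-order : ∀ x → x ^ N ≡ ε
  ^-order x = identityˡ-unique (x ^ N) ∏G (begin
    x ^ N ∙ ∏G                ≡⟨ cong (_∙ ∏G) (sym (∏.sum-replicate N {x})) ⟩
    ∏.sum {N} (λ _ → x) ∙ ∏G  ≡⟨ sym (∏.∑-distrib-+ (λ _ → x) (λ g → g)) ⟩
    ∏.sum (λ g → x ∙ g)       ≡⟨ sym (∏.sum-permute (λ g → g) translation) ⟩
    ∏G                        ∎)
    where
    ∏G = ∏.sum (λ g → g)
    translation = permutation (x ∙_) (x ⁻¹ ∙_) (\\-leftDividesˡ x) (\\-leftDividesʳ x)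

  sum-translate : ∀ a (F : Fin N → ℤ) → sum (λ g → F (a ∙ g)) ≡ sum F
  sum-translate a = sum-reindex (a ∙_) (a ⁻¹ ∙_) (\\-leftDividesˡ a) (\\-leftDividesʳ a)

  sum-inverse : ∀ (F : Fin N → ℤ) → sum (λ g → F (g ⁻¹)) ≡ sum F
  sum-inverse = sum-reindex _⁻¹ _⁻¹ ⁻¹-involutive ⁻¹-involutive

  ^-mod-3 : ∀ {x} → x ^ 3 ≡ ε → ∀ m → x ^ m ≡ x ^₃ (m mod 3)
  ^-mod-3 {x} x³≡ε m = begin
    x ^ m                            ≡⟨ cong (x ^_) (m≡m%n+[m/n]*n m 3) ⟩
    x ^ (m % 3 ℕ.+ m / 3 ℕ.* 3)      ≡⟨ ^-+ x (m % 3) (m / 3 ℕ.* 3) ⟩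
    x ^ (m % 3) ∙ x ^ (m / 3 ℕ.* 3)  ≡⟨ cong (x ^ (m % 3) ∙_) x^3q≡ε ⟩
    x ^ (m % 3) ∙ ε                  ≡⟨ identityʳ (x ^ (m % 3)) ⟩
    x ^ (m % 3)                      ≡⟨ cong (x ^_) (sym (FinP.toℕ-fromℕ< (m%n<n m 3))) ⟩
    x ^₃ (m mod 3)                   ∎
    where
    x^3q≡ε : x ^ (m / 3 ℕ.* 3) ≡ ε
    x^3q≡ε = trans (sym (^-* x (m / 3) 3)) (trans (cong (_^ (m / 3)) x³≡ε) (ε^ (m / 3)))

  module CubeRoot {x} (x³≡ε : x ^ 3 ≡ ε) where

    ^₃-+ : ∀ i j → x ^₃ (i +₃ j) ≡ x ^₃ i ∙ x ^₃ j
    ^₃-+ i j = trans (sym (^-mod-3 x³≡ε (toℕ i ℕ.+ toℕ j))) (^-+ x (toℕ i) (toℕ j))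

    ^₃-⁻¹ : ∀ i → x ^₃ (-₃ i) ≡ (x ^₃ i) ⁻¹
    ^₃-⁻¹ i = inverseʳ-unique (x ^₃ i) (x ^₃ (-₃ i))
                (trans (sym (^₃-+ i (-₃ i))) (cong (x ^₃_) (+₃-inverseʳ i)))

    module _ (x≢ε : x ≢ ε) where

      ^₃-kernel : ∀ i → x ^₃ i ≡ ε → i ≡ 0F
      ^₃-kernel 0F _    = refl
      ^₃-kernel 1F x≡ε  = ⊥-elim (x≢ε (trans (sym (identityʳ x)) x≡ε))
      ^₃-kernel 2F x²≡ε = ⊥-elim (x≢ε (begin
        x                  ≡⟨ sym (identityʳ x) ⟩
        x ^₃ (2F +₃ 2F)    ≡⟨ ^₃-+ 2F 2F ⟩
        x ^₃ 2F ∙ x ^₃ 2F  ≡⟨ cong₂ _∙_ x²≡ε x²≡ε ⟩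
        ε ∙ ε              ≡⟨ identityˡ ε ⟩
        ε                  ∎))

      ^₃-injective : Injective _≡_ _≡_ (x ^₃_)
      ^₃-injective {i} {j} xⁱ≡xʲ = +₃-cancel i j (^₃-kernel (i +₃ -₃ j) (begin
        x ^₃ (i +₃ -₃ j)      ≡⟨ ^₃-+ i (-₃ j) ⟩
        x ^₃ i ∙ x ^₃ (-₃ j)  ≡⟨ cong₂ _∙_ xⁱ≡xʲ (^₃-⁻¹ j) ⟩
        x ^₃ j ∙ (x ^₃ j) ⁻¹  ≡⟨ inverseʳ (x ^₃ j) ⟩
        ε                     ∎))

  lagrange : ∀ {k} (ι : Fin k → Fin N) → Injective _≡_ _≡_ ι → (∃[ u ] ι u ≡ ε) →
             (∀ s → ∃[ u ] ι u ≡ ι s ⁻¹) → (∀ s t → ∃[ u ] ι u ≡ ι s ∙ ι t) → k ∣ N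
  lagrange {k} ι ι-injective (e , ιe≡ε) inverse product =
    divides ℤ.∣ cosets ∣ (trans (cong ℤ.∣_∣ N≡cosets*k) (ℤP.abs-* cosets (+ k)))
    where
    coset : Fin N → Fin k → Fin N
    coset g t = g ∙ ι t

    _~_ : Rel (Fin N) 0ℓ
    g ~ h = InImage (coset g) h

    ~-refl : ∀ {g} → g ~ g
    ~-refl {g} = e , trans (cong (g ∙_) ιe≡ε) (identityʳ g)

    ~-sym : ∀ {g h} → g ~ h → h ~ g
    ~-sym {g} {h} (t , g∙ιt≡h) with inverse t
    ... | u , ιu≡ιt⁻¹ = u , (begin
      h ∙ ι u           ≡⟨ cong₂ _∙_ (sym g∙ιt≡h) ιu≡ιt⁻¹ ⟩
      g ∙ ι t ∙ ι t ⁻¹  ≡⟨ //-rightDividesʳ (ι t) g ⟩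
      g                 ∎)

    ~-trans : ∀ {g h r} → g ~ h → h ~ r → g ~ r
    ~-trans {g} {h} {r} (s , g∙ιs≡h) (t , h∙ιt≡r) with product s t
    ... | u , ιu≡ιs∙ιt = u , (begin
      g ∙ ι u          ≡⟨ cong (g ∙_) ιu≡ιs∙ιt ⟩
      g ∙ (ι s ∙ ι t)  ≡⟨ sym (assoc g (ι s) (ι t)) ⟩
      g ∙ ι s ∙ ι t    ≡⟨ cong (_∙ ι t) g∙ιs≡h ⟩
      h ∙ ι t          ≡⟨ h∙ιt≡r ⟩
      r                ∎)

    ~-isDecEquivalence : IsDecEquivalence _~_
    ~-isDecEquivalence = record
      { isEquivalence = record { refl = ~-refl ; sym = ~-sym ; trans = ~-trans }
      ; _≟_           = λ g → inImage? (coset g)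
      }

    open ClassCounting ~-isDecEquivalence

    cosets : ℤ
    cosets = sum (λ g → ind (leastOfClass? g))

    coset-size : ∀ g → classSize g ≡ + k
    coset-size g = sum-image (coset g) (λ {s} {t} eq → ι-injective (∙-cancelˡ g (ι s) (ι t) eq))

    N≡cosets*k : + N ≡ cosets * + k
    N≡cosets*k = begin
      + N
        ≡⟨ count-by-classes ⟩
      sum (λ g → ind (leastOfClass? g) * classSize g)
        ≡⟨ sum-cong-≗ (λ g → cong (ind (leastOfClass? g) *_) (coset-size g)) ⟩
      sum (λ g → ind (leastOfClass? g) * + k)
        ≡⟨ sym (*-distribʳ-sum (+ k) (λ g → ind (leastOfClass? g))) ⟩
      cosets * + k
        ∎

  [y∙[x∙y]⁻¹]⁻¹≡x : ∀ x y → (y ∙ (x ∙ y) ⁻¹) ⁻¹ ≡ x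
  [y∙[x∙y]⁻¹]⁻¹≡x x y = begin
    (y ∙ (x ∙ y) ⁻¹) ⁻¹   ≡⟨ ⁻¹-anti-homo-∙ y ((x ∙ y) ⁻¹) ⟩
    (x ∙ y) ⁻¹ ⁻¹ ∙ y ⁻¹  ≡⟨ cong (_∙ y ⁻¹) (⁻¹-involutive (x ∙ y)) ⟩
    x ∙ y ∙ y ⁻¹          ≡⟨ //-rightDividesʳ y x ⟩
    x                     ∎

  [x∙x]⁻¹≡x⇒x³≡ε : ∀ {x} → (x ∙ x) ⁻¹ ≡ x → x ^ 3 ≡ ε
  [x∙x]⁻¹≡x⇒x³≡ε {x} [x∙x]⁻¹≡x = begin
    x ∙ (x ∙ (x ∙ ε))   ≡⟨ cong (λ y → x ∙ (x ∙ y)) (identityʳ x) ⟩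
    x ∙ (x ∙ x)         ≡⟨ comm x (x ∙ x) ⟩
    x ∙ x ∙ x           ≡⟨ cong (x ∙ x ∙_) (sym [x∙x]⁻¹≡x) ⟩
    x ∙ x ∙ (x ∙ x) ⁻¹  ≡⟨ inverseʳ (x ∙ x) ⟩
    ε                   ∎

  -- McKay's argument: (a , b) ↦ (b , (a ∙ b) ⁻¹) is a permutation of order 3 of the N * N pairs,
  -- whose fixed points are the (a , a) with a ^ 3 ≡ ε.
  cauchy₃ : 3 ∣ N → ∃[ x ] x ≢ ε × x ^ 3 ≡ ε
  cauchy₃ 3∣N with FinP.any? (λ x → ¬? (x ≟ ε) ×-dec (x ^ 3 ≟ ε))
  ... | yes (x , x≢ε , x³≡ε) = x , x≢ε , x³≡ε
  ... | no ∄x = ⊥-elim (multiple-of-3≢1+3* W (∣m⇒∣m*n N 3∣N) N*N≡1+3W)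
    where
    rotate : Fin N × Fin N → Fin N × Fin N
    rotate (a , b) = b , (a ∙ b) ⁻¹

    rotate³≡id : ∀ p → rotate (rotate (rotate p)) ≡ p
    rotate³≡id (a , b) = cong₂ _,_ ([y∙[x∙y]⁻¹]⁻¹≡x a b) ([y∙[x∙y]⁻¹]⁻¹≡x b ((a ∙ b) ⁻¹))

    rotate-fixed⇒trivial : ∀ p → rotate p ≡ p → p ≡ (ε , ε)
    rotate-fixed⇒trivial (a , b) rotate≡id = cong₂ _,_ a≡ε (trans b≡a a≡ε)
      where
      b≡a : b ≡ a
      b≡a = cong proj₁ rotate≡id
      [a∙a]⁻¹≡a : (a ∙ a) ⁻¹ ≡ a
      [a∙a]⁻¹≡a = trans (cong (λ y → (a ∙ y) ⁻¹) (sym b≡a)) (trans (cong proj₂ rotate≡id) b≡a)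
      a≡ε : a ≡ ε
      a≡ε = decidable-stable (a ≟ ε) (λ a≢ε → ∄x (a , a≢ε , [x∙x]⁻¹≡x⇒x³≡ε [a∙a]⁻¹≡a))

    split : Fin (N ℕ.* N) → Fin N × Fin N
    split = Fin.remQuot {N} N

    join : Fin N × Fin N → Fin (N ℕ.* N)
    join = uncurry Fin.combine

    join-split : ∀ t → join (split t) ≡ t
    join-split = FinP.combine-remQuot {N} N

    rot : Fin (N ℕ.* N) → Fin (N ℕ.* N)
    rot t = join (rotate (split t))

    split-rot : ∀ t → split (rot t) ≡ rotate (split t)
    split-rot t = FinP.remQuot-combine _ _

    rot³≡id : ∀ t → rot (rot (rot t)) ≡ t
    rot³≡id t = begin
      rot (rot (rot t))
        ≡⟨ cong (join ∘ rotate) (trans (split-rot (rot t)) (cong rotate (split-rot t))) ⟩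
      join (rotate (rotate (rotate (split t))))
        ≡⟨ cong join (rotate³≡id (split t)) ⟩
      join (split t)
        ≡⟨ join-split t ⟩
      t ∎

    origin : Fin (N ℕ.* N)
    origin = join (ε , ε)

    rot-origin : rot origin ≡ origin
    rot-origin = trans (cong (join ∘ rotate) (FinP.remQuot-combine ε ε))
                       (cong (Fin.combine ε) (trans (cong _⁻¹ (identityˡ ε)) ε⁻¹≈ε))

    rot-fixed⇒origin : ∀ {t} → rot t ≡ t → t ≡ origin
    rot-fixed⇒origin {t} rot-t≡t = begin
      t               ≡⟨ sym (join-split t) ⟩
      join (split t)  ≡⟨ cong join (rotate-fixed⇒trivial (split t) rotate-fixed) ⟩
      origin          ∎
      where
      rotate-fixed : rotate (split t) ≡ split t
      rotate-fixed = trans (sym (split-rot t)) (cong split rot-t≡t)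

    open OrderThreePermutation rot rot³≡id using (size≡fixed+3*)

    W : ℤ
    W = proj₁ size≡fixed+3*

    N*N≡1+3W : + (N ℕ.* N) ≡ + 1 + + 3 * W
    N*N≡1+3W = trans (proj₂ size≡fixed+3*)
                     (cong (_+ + 3 * W) (sum-ind-unique (λ t → rot t ≟ t) rot-origin rot-fixed⇒origin))

  -- If the cube root y were not a power of x, the x ^ i ∙ y ^ j would form a subgroup of order 9.
  cube-roots-cyclic : ¬ 9 ∣ N → ∀ {x} → x ≢ ε → x ^ 3 ≡ ε →
                      ∀ {y} → y ^ 3 ≡ ε → ∃[ i ] x ^₃ i ≡ y
  cube-roots-cyclic 9∤N {x} x≢ε x³≡ε {y} y³≡ε with FinP.any? (λ i → x ^₃ i ≟ y)
  ... | yes y∈⟨x⟩ = y∈⟨x⟩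
  ... | no  y∉⟨x⟩ = ⊥-elim (9∤N (lagrange ι ι-injective (join (0F , 0F) , ι-origin) ι-⁻¹ ι-∙))
    where
    module X = CubeRoot x³≡ε
    module Y = CubeRoot y³≡ε

    pair : Fin 3 × Fin 3 → Fin N
    pair (i , j) = x ^₃ i ∙ y ^₃ j

    pair-∙ : ∀ i j i′ j′ → pair (i +₃ i′ , j +₃ j′) ≡ pair (i , j) ∙ pair (i′ , j′)
    pair-∙ i j i′ j′ = trans (cong₂ _∙_ (X.^₃-+ i i′) (Y.^₃-+ j j′)) (interchange _ _ _ _)

    pair-⁻¹ : ∀ i j → pair (-₃ i , -₃ j) ≡ pair (i , j) ⁻¹
    pair-⁻¹ i j = trans (cong₂ _∙_ (X.^₃-⁻¹ i) (Y.^₃-⁻¹ j)) (⁻¹-∙-comm (x ^₃ i) (y ^₃ j))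

    y-power∈⟨x⟩⇒0 : ∀ j a → y ^₃ j ≡ x ^₃ a → j ≡ 0F
    y-power∈⟨x⟩⇒0 0F a _      = refl
    y-power∈⟨x⟩⇒0 1F a y≡xᵃ   = ⊥-elim (y∉⟨x⟩ (a , trans (sym y≡xᵃ) (identityʳ y)))
    y-power∈⟨x⟩⇒0 2F a y²≡xᵃ  = ⊥-elim (y∉⟨x⟩ (a +₃ a , (begin
      x ^₃ (a +₃ a)      ≡⟨ X.^₃-+ a a ⟩
      x ^₃ a ∙ x ^₃ a    ≡⟨ sym (cong₂ _∙_ y²≡xᵃ y²≡xᵃ) ⟩
      y ^₃ 2F ∙ y ^₃ 2F  ≡⟨ sym (Y.^₃-+ 2F 2F) ⟩
      y ∙ ε              ≡⟨ identityʳ y ⟩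
      y                  ∎)))

    pair-kernel : ∀ i j → pair (i , j) ≡ ε → (i , j) ≡ (0F , 0F)
    pair-kernel i j pair≡ε = cong₂ _,_ (X.^₃-kernel x≢ε i xⁱ≡ε) j≡0
      where
      j≡0 : j ≡ 0F
      j≡0 = y-power∈⟨x⟩⇒0 j (-₃ i)
              (trans (inverseʳ-unique (x ^₃ i) (y ^₃ j) pair≡ε) (sym (X.^₃-⁻¹ i)))
      xⁱ≡ε : x ^₃ i ≡ ε
      xⁱ≡ε = trans (sym (identityʳ (x ^₃ i))) (trans (cong (λ j → pair (i , j)) (sym j≡0)) pair≡ε)

    pair-injective : Injective _≡_ _≡_ pair
    pair-injective {i , j} {i′ , j′} pair≡ with pair-kernel (i +₃ -₃ i′) (j +₃ -₃ j′) (begin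
      pair (i +₃ -₃ i′ , j +₃ -₃ j′)       ≡⟨ pair-∙ i j (-₃ i′) (-₃ j′) ⟩
      pair (i , j) ∙ pair (-₃ i′ , -₃ j′)  ≡⟨ cong₂ _∙_ pair≡ (pair-⁻¹ i′ j′) ⟩
      pair (i′ , j′) ∙ pair (i′ , j′) ⁻¹   ≡⟨ inverseʳ (pair (i′ , j′)) ⟩
      ε                                    ∎)
    ... | eq = cong₂ _,_ (+₃-cancel i i′ (cong proj₁ eq)) (+₃-cancel j j′ (cong proj₂ eq))

    split : Fin 9 → Fin 3 × Fin 3
    split = Fin.remQuot {3} 3

    join : Fin 3 × Fin 3 → Fin 9
    join = uncurry Fin.combine

    ι : Fin 9 → Fin N
    ι = pair ∘ split

    ι-join : ∀ p → ι (join p) ≡ pair p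
    ι-join (i , j) = cong pair (FinP.remQuot-combine i j)

    ι-injective : Injective _≡_ _≡_ ι
    ι-injective {s} {t} ιs≡ιt = begin
      s               ≡⟨ sym (FinP.combine-remQuot {3} 3 s) ⟩
      join (split s)  ≡⟨ cong join (pair-injective {split s} {split t} ιs≡ιt) ⟩
      join (split t)  ≡⟨ FinP.combine-remQuot {3} 3 t ⟩
      t               ∎

    ι-origin : ι (join (0F , 0F)) ≡ ε
    ι-origin = trans (ι-join (0F , 0F)) (identityˡ ε)

    ι-⁻¹ : ∀ s → ∃[ u ] ι u ≡ ι s ⁻¹
    ι-⁻¹ s = join (-₃ i , -₃ j) , trans (ι-join (-₃ i , -₃ j)) (pair-⁻¹ i j)
      where
      i = proj₁ (split s)
      j = proj₂ (split s)

    ι-∙ : ∀ s t → ∃[ u ] ι u ≡ ι s ∙ ι t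
    ι-∙ s t = join (i +₃ i′ , j +₃ j′) , trans (ι-join (i +₃ i′ , j +₃ j′)) (pair-∙ i j i′ j′)
      where
      i  = proj₁ (split s)
      j  = proj₂ (split s)
      i′ = proj₁ (split t)
      j′ = proj₂ (split t)

  record EpimorphismToℤ₃ : Set where
    field
      φ   : Fin N → Fin 3
      φ-∙ : ∀ a b → φ (a ∙ b) ≡ φ a +₃ φ b
      z   : Fin N
      φ-z : φ z ≡ 1F

  -- The cube roots of ε form ⟨x⟩ ≅ ℤ/3, and h ↦ h ^ M maps G onto them, fixing x as M ≡ 1 (mod 3).
  epimorphismToℤ₃ : ∀ M → N ≡ 3 ℕ.* M → M % 3 ≡ 1 → EpimorphismToℤ₃
  epimorphismToℤ₃ M N≡3M M%3≡1 = record { φ = φ ; φ-∙ = φ-∙ ; z = x ; φ-z = φ-x }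
    where
    3∣N : 3 ∣ N
    3∣N = divides M (trans N≡3M (ℕP.*-comm 3 M))

    9∤N : ¬ 9 ∣ N
    9∤N 9∣N with trans (sym (n∣m⇒m%n≡0 M 3 (*-cancelˡ-∣ 3 (subst (9 ∣_) N≡3M 9∣N)))) M%3≡1
    ... | ()

    x : Fin N
    x = proj₁ (cauchy₃ 3∣N)

    x≢ε : x ≢ ε
    x≢ε = proj₁ (proj₂ (cauchy₃ 3∣N))

    x³≡ε : x ^ 3 ≡ ε
    x³≡ε = proj₂ (proj₂ (cauchy₃ 3∣N))

    module X = CubeRoot x³≡ε

    log : ∀ h → ∃[ i ] x ^₃ i ≡ h ^ M
    log h = cube-roots-cyclic 9∤N x≢ε x³≡ε (trans (^-* h 3 M) (trans (cong (h ^_) (sym N≡3M)) (^-order h)))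

    φ : Fin N → Fin 3
    φ h = proj₁ (log h)

    φ-∙ : ∀ a b → φ (a ∙ b) ≡ φ a +₃ φ b
    φ-∙ a b = X.^₃-injective x≢ε (begin
      x ^₃ φ (a ∙ b)       ≡⟨ proj₂ (log (a ∙ b)) ⟩
      (a ∙ b) ^ M          ≡⟨ ^-∙ a b M ⟩
      a ^ M ∙ b ^ M        ≡⟨ sym (cong₂ _∙_ (proj₂ (log a)) (proj₂ (log b))) ⟩
      x ^₃ φ a ∙ x ^₃ φ b  ≡⟨ sym (X.^₃-+ (φ a) (φ b)) ⟩
      x ^₃ (φ a +₃ φ b)    ∎)

    M-mod-3 : M mod 3 ≡ 1F
    M-mod-3 = FinP.toℕ-injective (trans (FinP.toℕ-fromℕ< (m%n<n M 3)) M%3≡1)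

    φ-x : φ x ≡ 1F
    φ-x = X.^₃-injective x≢ε (begin
      x ^₃ φ x        ≡⟨ proj₂ (log x) ⟩
      x ^ M           ≡⟨ ^-mod-3 x³≡ε M ⟩
      x ^₃ (M mod 3)  ≡⟨ cong (x ^₃_) M-mod-3 ⟩
      x ^₃ 1F         ∎)

-- The real part of a cubic character

module CubicCharacter {N} {G : FinAbGroup N} (epi : FinAbGroupProperties.EpimorphismToℤ₃ G) where
  open FinAbGroupProperties G
  open EpimorphismToℤ₃ epi

  private
    x*[y*z]≡y*[x*z] : ∀ x y z → x * (y * z) ≡ y * (x * z)
    x*[y*z]≡y*[x*z] = solve-∀

    a≡b+[a-b] : ∀ a b → a ≡ b + (a - b)
    a≡b+[a-b] = solve-∀

  φ-ε : φ ε ≡ 0F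
  φ-ε = +₃-idem⇒0 (φ ε) (trans (sym (φ-∙ ε ε)) (cong φ (identityˡ ε)))

  φ-⁻¹ : ∀ g → φ (g ⁻¹) ≡ -₃ φ g
  φ-⁻¹ g = +₃-inverse-unique (φ g) (φ (g ⁻¹))
             (trans (sym (φ-∙ g (g ⁻¹))) (trans (cong φ (inverseʳ g)) φ-ε))

  Symmetric : GroupRing N → Set
  Symmetric A = ∀ g → A (g ⁻¹) ≡ A g

  Odd : (Fin 3 → ℤ) → Set
  Odd u = ∀ t → u (-₃ t) ≡ - u t

  ⟨_,_⟩ : (Fin 3 → ℤ) → GroupRing N → ℤ
  ⟨ u , A ⟩ = sum (λ g → u (φ g) * A g)

  pairing-odd : ∀ {u A} → Odd u → Symmetric A → ⟨ u , A ⟩ ≡ + 0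
  pairing-odd {u} {A} u-odd A-sym = self-neg⇒0 (begin
    ⟨ u , A ⟩
      ≡⟨ sym (sum-inverse (λ g → u (φ g) * A g)) ⟩
    sum (λ g → u (φ (g ⁻¹)) * A (g ⁻¹))
      ≡⟨ sum-cong-≗ (λ g → cong₂ _*_ (trans (cong u (φ-⁻¹ g)) (u-odd (φ g))) (A-sym g)) ⟩
    sum (λ g → - u (φ g) * A g)
      ≡⟨ sum-cong-≗ (λ g → sym (ℤP.neg-distribˡ-* (u (φ g)) (A g))) ⟩
    sum (λ g → - (u (φ g) * A g))
      ≡⟨ sum-neg (λ g → u (φ g) * A g) ⟩
    - ⟨ u , A ⟩
      ∎)

  pairing-mod-odd : ∀ {u v d A} → Odd d → Symmetric A → (∀ t → u t ≡ v t + d t) →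
                    ⟨ u , A ⟩ ≡ ⟨ v , A ⟩
  pairing-mod-odd {u} {v} {d} {A} d-odd A-sym u≡v+d = begin
    ⟨ u , A ⟩
      ≡⟨ sum-cong-≗ split ⟩
    sum (λ g → v (φ g) * A g + d (φ g) * A g)
      ≡⟨ ∑-distrib-+ (λ g → v (φ g) * A g) (λ g → d (φ g) * A g) ⟩
    ⟨ v , A ⟩ + ⟨ d , A ⟩
      ≡⟨ cong (λ s → ⟨ v , A ⟩ + s) (pairing-odd d-odd A-sym) ⟩
    ⟨ v , A ⟩ + + 0
      ≡⟨ ℤP.+-identityʳ ⟨ v , A ⟩ ⟩
    ⟨ v , A ⟩
      ∎
    where
    split : ∀ g → u (φ g) * A g ≡ v (φ g) * A g + d (φ g) * A g
    split g = trans (cong (_* A g) (u≡v+d (φ g))) (ℤP.*-distribʳ-+ (A g) (v (φ g)) (d (φ g)))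

  pairing-*ˡ : ∀ c u A → ⟨ (λ t → c * u t) , A ⟩ ≡ c * ⟨ u , A ⟩
  pairing-*ˡ c u A = trans (sum-cong-≗ (λ g → ℤP.*-assoc c (u (φ g)) (A g)))
                           (sym (*-distribˡ-sum c (λ g → u (φ g) * A g)))

  -- Re ω ^ t is 1, -1/2, -1/2 for t = 0, 1, 2.  On symmetric elements the coefficient sums over φ ⁻¹ 1 and
  -- φ ⁻¹ 2 agree, so these integral weights give the same value of the real character.
  w : Fin 3 → ℤ
  w 0F = + 1
  w 1F = - + 1
  w 2F = + 0

  D : GroupRing N → ℤ
  D A = ⟨ w , A ⟩

  -- w is multiplicative up to odd functions, and those pair to 0 with symmetric elements.
  w-shift-defect-odd : ∀ t → Odd (λ s → w (t +₃ s) - w t * w s)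
  w-shift-defect-odd 0F 0F = refl
  w-shift-defect-odd 0F 1F = refl
  w-shift-defect-odd 0F 2F = refl
  w-shift-defect-odd 1F 0F = refl
  w-shift-defect-odd 1F 1F = refl
  w-shift-defect-odd 1F 2F = refl
  w-shift-defect-odd 2F 0F = refl
  w-shift-defect-odd 2F 1F = refl
  w-shift-defect-odd 2F 2F = refl

  w-double-defect-odd : Odd (λ s → w (s +₃ s) - w s)
  w-double-defect-odd 0F = refl
  w-double-defect-odd 1F = refl
  w-double-defect-odd 2F = refl

  D-shift : ∀ {B} → Symmetric B → ∀ a → sum (λ g → w (φ (a ∙ g)) * B g) ≡ w (φ a) * D B
  D-shift {B} B-sym a = begin
    sum (λ g → w (φ (a ∙ g)) * B g)
      ≡⟨ sum-cong-≗ (λ g → cong (λ t → w t * B g) (φ-∙ a g)) ⟩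
    ⟨ (λ s → w (φ a +₃ s)) , B ⟩
      ≡⟨ pairing-mod-odd {v = λ s → w (φ a) * w s} (w-shift-defect-odd (φ a)) B-sym w-shift ⟩
    ⟨ (λ s → w (φ a) * w s) , B ⟩
      ≡⟨ pairing-*ˡ (w (φ a)) w B ⟩
    w (φ a) * D B
      ∎
    where
    w-shift : ∀ s → w (φ a +₃ s) ≡ w (φ a) * w s + (w (φ a +₃ s) - w (φ a) * w s)
    w-shift s = a≡b+[a-b] (w (φ a +₃ s)) (w (φ a) * w s)

  D-⊛ : ∀ A {B} → Symmetric B → D (_⊛_ G A B) ≡ D A * D B
  D-⊛ A {B} B-sym = begin
    sum (λ g → w (φ g) * Σℤ (λ h → A h * B (h ⁻¹ ∙ g)))
      ≡⟨ sum-cong-≗ (λ g → trans (cong (w (φ g) *_) (Σℤ≡sum (λ h → A h * B (h ⁻¹ ∙ g))))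
                                 (*-distribˡ-sum (w (φ g)) (λ h → A h * B (h ⁻¹ ∙ g)))) ⟩
    sum (λ g → sum (λ h → w (φ g) * (A h * B (h ⁻¹ ∙ g))))
      ≡⟨ ∑-comm (λ g h → w (φ g) * (A h * B (h ⁻¹ ∙ g))) ⟩
    sum (λ h → sum (λ g → w (φ g) * (A h * B (h ⁻¹ ∙ g))))
      ≡⟨ sum-cong-≗ (λ h → trans (sum-cong-≗ (λ g → x*[y*z]≡y*[x*z] (w (φ g)) (A h) (B (h ⁻¹ ∙ g))))
                                 (sym (*-distribˡ-sum (A h) (λ g → w (φ g) * B (h ⁻¹ ∙ g))))) ⟩
    sum (λ h → A h * sum (λ g → w (φ g) * B (h ⁻¹ ∙ g)))
      ≡⟨ sum-cong-≗ (λ h → cong (A h *_) (trans (sym (translate h)) (D-shift B-sym h))) ⟩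
    sum (λ h → A h * (w (φ h) * D B))
      ≡⟨ sum-cong-≗ (λ h → trans (x*[y*z]≡y*[x*z] (A h) (w (φ h)) (D B))
                                 (sym (ℤP.*-assoc (w (φ h)) (A h) (D B)))) ⟩
    sum (λ h → w (φ h) * A h * D B)
      ≡⟨ sym (*-distribʳ-sum (D B) (λ h → w (φ h) * A h)) ⟩
    D A * D B
      ∎
    where
    translate : ∀ h → sum (λ g → w (φ (h ∙ g)) * B g) ≡ sum (λ g → w (φ g) * B (h ⁻¹ ∙ g))
    translate h = trans (sum-cong-≗ (λ g → cong (λ g′ → w (φ (h ∙ g)) * B g′) (sym (\\-leftDividesʳ h g))))
                        (sum-translate h (λ g → w (φ g) * B (h ⁻¹ ∙ g)))

  D-⁽²⁾ : ∀ {A} → Symmetric A → D (_⁽²⁾ G A) ≡ D A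
  D-⁽²⁾ {A} A-sym = begin
    sum (λ g → w (φ g) * Σℤ (λ h → A h * δ (h ∙ h) g))
      ≡⟨ sum-cong-≗ (λ g → trans (cong (w (φ g) *_) (Σℤ≡sum (λ h → A h * δ (h ∙ h) g)))
                                 (*-distribˡ-sum (w (φ g)) (λ h → A h * δ (h ∙ h) g))) ⟩
    sum (λ g → sum (λ h → w (φ g) * (A h * δ (h ∙ h) g)))
      ≡⟨ ∑-comm (λ g h → w (φ g) * (A h * δ (h ∙ h) g)) ⟩
    sum (λ h → sum (λ g → w (φ g) * (A h * δ (h ∙ h) g)))
      ≡⟨ sum-cong-≗ square-coefficient ⟩
    ⟨ (λ s → w (s +₃ s)) , A ⟩
      ≡⟨ pairing-mod-odd {v = w} w-double-defect-odd A-sym (λ s → a≡b+[a-b] (w (s +₃ s)) (w s)) ⟩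
    D A
      ∎
    where
    square-coefficient : ∀ h → sum (λ g → w (φ g) * (A h * δ (h ∙ h) g)) ≡ w (φ h +₃ φ h) * A h
    square-coefficient h = begin
      sum (λ g → w (φ g) * (A h * δ (h ∙ h) g))
        ≡⟨ sum-cong-≗ (λ g → trans (x*[y*z]≡y*[x*z] (w (φ g)) (A h) (δ (h ∙ h) g))
                                   (trans (sym (ℤP.*-assoc (A h) (w (φ g)) (δ (h ∙ h) g)))
                                          (cong (A h * w (φ g) *_) (δ-sym (h ∙ h) g)))) ⟩
      sum (λ g → A h * w (φ g) * δ g (h ∙ h))
        ≡⟨ sum-δ (λ g → A h * w (φ g)) (h ∙ h) ⟩
      A h * w (φ (h ∙ h))
        ≡⟨ ℤP.*-comm (A h) (w (φ (h ∙ h))) ⟩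
      w (φ (h ∙ h)) * A h
        ≡⟨ cong (λ t → w t * A h) (φ-∙ h h) ⟩
      w (φ h +₃ φ h) * A h
        ∎

  D-𝟙e : D (𝟙e G) ≡ + 1
  D-𝟙e = trans (sum-δ (λ g → w (φ g)) ε) (cong w φ-ε)

  D-𝟙H : D (𝟙H G) ≡ + 0
  D-𝟙H = self-neg⇒0 (begin
    D (𝟙H G)                         ≡⟨ sym (sum-translate z (λ g → w (φ g) * + 1)) ⟩
    sum (λ g → w (φ (z ∙ g)) * + 1)  ≡⟨ D-shift (λ _ → refl) z ⟩
    w (φ z) * D (𝟙H G)               ≡⟨ cong (λ t → w t * D (𝟙H G)) φ-z ⟩
    - + 1 * D (𝟙H G)                 ≡⟨ ℤP.-1*i≡-i (D (𝟙H G)) ⟩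
    - D (𝟙H G)                       ∎)

  D-cong : ∀ {A B} → (∀ g → A g ≡ B g) → D A ≡ D B
  D-cong A≗B = sum-cong-≗ (λ g → cong (w (φ g) *_) (A≗B g))

  D-⊕ : ∀ A B → D (A ⊕ B) ≡ D A + D B
  D-⊕ A B = trans (sum-cong-≗ (λ g → ℤP.*-distribˡ-+ (w (φ g)) (A g) (B g)))
                  (∑-distrib-+ (λ g → w (φ g) * A g) (λ g → w (φ g) * B g))

  D-⊖ : ∀ A B → D (A ⊖ B) ≡ D A - D B
  D-⊖ A B = begin
    sum (λ g → w (φ g) * (A g - B g))
      ≡⟨ sum-cong-≗ (λ g → distrib (w (φ g)) (A g) (B g)) ⟩
    sum (λ g → w (φ g) * A g + - (w (φ g) * B g))
      ≡⟨ ∑-distrib-+ (λ g → w (φ g) * A g) (λ g → - (w (φ g) * B g)) ⟩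
    D A + sum (λ g → - (w (φ g) * B g))
      ≡⟨ cong (λ s → D A + s) (sum-neg (λ g → w (φ g) * B g)) ⟩
    D A - D B
      ∎
    where
    distrib : ∀ x y z → x * (y - z) ≡ x * y + - (x * z)
    distrib = solve-∀

  D-· : ∀ k A → D (k · A) ≡ k * D A
  D-· k A = trans (sum-cong-≗ (λ g → x*[y*z]≡y*[x*z] (w (φ g)) k (A g)))
                  (sym (*-distribˡ-sum k (λ g → w (φ g) * A g)))

  module _ {S₀ S₁ : GroupRing N} (S₀-sym : Symmetric S₀) (S₁-sym : Symmetric S₁) where

    D-product-equation : (∀ g → _⊛_ G S₀ S₁ g ≡ (𝟙H G ⊖ 𝟙e G) g) → D S₀ * D S₁ ≡ - + 1
    D-product-equation S₀S₁≡H-e = begin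
      D S₀ * D S₁          ≡⟨ sym (D-⊛ S₀ S₁-sym) ⟩
      D (_⊛_ G S₀ S₁)      ≡⟨ D-cong S₀S₁≡H-e ⟩
      D (𝟙H G ⊖ 𝟙e G)      ≡⟨ D-⊖ (𝟙H G) (𝟙e G) ⟩
      D (𝟙H G) - D (𝟙e G)  ≡⟨ cong₂ _-_ D-𝟙H D-𝟙e ⟩
      - + 1                ∎

    D-squares-equation : ∀ k →
      (∀ g → (_⊛_ G S₀ S₀ ⊕ _⊛_ G S₁ S₁) g
             ≡ (((((+ 2) · 𝟙H G) ⊖ _⁽²⁾ G S₀) ⊖ _⁽²⁾ G S₁) ⊕ (k · 𝟙e G)) g) →
      D S₀ * D S₀ + D S₁ * D S₁ ≡ k - D S₀ - D S₁
    D-squares-equation k squares≡ = begin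
      D S₀ * D S₀ + D S₁ * D S₁
        ≡⟨ sym (trans (D-⊕ _ _) (cong₂ _+_ (D-⊛ S₀ S₀-sym) (D-⊛ S₁ S₁-sym))) ⟩
      D (_⊛_ G S₀ S₀ ⊕ _⊛_ G S₁ S₁)
        ≡⟨ trans (D-cong squares≡) (D-⊕ _ _) ⟩
      D ((((+ 2) · 𝟙H G) ⊖ _⁽²⁾ G S₀) ⊖ _⁽²⁾ G S₁) + D (k · 𝟙e G)
        ≡⟨ cong₂ _+_ (trans (D-⊖ _ _) (cong₂ _-_ (D-⊖ _ _) (D-⁽²⁾ S₁-sym))) (D-· k (𝟙e G)) ⟩
      D ((+ 2) · 𝟙H G) - D (_⁽²⁾ G S₀) - D S₁ + k * D (𝟙e G)
        ≡⟨ cong₂ (λ a b → a - D S₁ + k * b) (cong₂ _-_ (trans (D-· (+ 2) (𝟙H G)) (cong (+ 2 *_) D-𝟙H))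
                                                     (D-⁽²⁾ S₀-sym)) D-𝟙e ⟩
      + 2 * + 0 - D S₀ - D S₁ + k * + 1
        ≡⟨ normalise k (D S₀) (D S₁) ⟩
      k - D S₀ - D S₁
        ∎
      where
      normalise : ∀ k x y → + 2 * + 0 - x - y + k * + 1 ≡ k - x - y
      normalise = solve-∀

-- Arithmetic

∣i∣≡1⇒i≡±1 : ∀ i → ℤ.∣ i ∣ ≡ 1 → i ≡ + 1 ⊎ i ≡ - + 1
∣i∣≡1⇒i≡±1 (+ .1)       refl = inj₁ refl
∣i∣≡1⇒i≡±1 -[1+ zero ]  _    = inj₂ refl
∣i∣≡1⇒i≡±1 -[1+ suc _ ] ()

x*y≡-1⇒x+y≡0 : ∀ {x y} → x * y ≡ - + 1 → x + y ≡ + 0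
x*y≡-1⇒x+y≡0 {x} {y} xy≡-1
  with ∣i∣≡1⇒i≡±1 x (ℕP.m*n≡1⇒m≡1 ℤ.∣ x ∣ ℤ.∣ y ∣ ∣x∣∣y∣≡1)
     | ∣i∣≡1⇒i≡±1 y (ℕP.m*n≡1⇒n≡1 ℤ.∣ x ∣ ℤ.∣ y ∣ ∣x∣∣y∣≡1)
  where
  ∣x∣∣y∣≡1 : ℤ.∣ x ∣ ℕ.* ℤ.∣ y ∣ ≡ 1
  ∣x∣∣y∣≡1 = trans (sym (ℤP.abs-* x y)) (cong ℤ.∣_∣ xy≡-1)
x*y≡-1⇒x+y≡0 () | inj₁ refl | inj₁ refl
x*y≡-1⇒x+y≡0 _  | inj₁ refl | inj₂ refl = refl
x*y≡-1⇒x+y≡0 _  | inj₂ refl | inj₁ refl = refl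
x*y≡-1⇒x+y≡0 () | inj₂ refl | inj₂ refl

x*y≡-1∧x²+y²≡k-x-y⇒k≡2 : ∀ {x y k} → x * y ≡ - + 1 → x * x + y * y ≡ k - x - y → k ≡ + 2
x*y≡-1∧x²+y²≡k-x-y⇒k≡2 {x} {y} {k} xy≡-1 x²+y²≡k-x-y = begin
  k                                  ≡⟨ k≡[k-x-y]+[x+y] k x y ⟩
  (k - x - y) + (x + y)              ≡⟨ cong₂ _+_ (sym x²+y²≡k-x-y) x+y≡0 ⟩
  (x * x + y * y) + + 0              ≡⟨ sum-of-squares x y ⟩
  (x + y) * (x + y) - + 2 * (x * y)  ≡⟨ cong₂ (λ s p → s * s - + 2 * p) x+y≡0 xy≡-1 ⟩
  + 2                                ∎
  where
  x+y≡0 : x + y ≡ + 0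
  x+y≡0 = x*y≡-1⇒x+y≡0 {x} {y} xy≡-1
  k≡[k-x-y]+[x+y] : ∀ k x y → k ≡ (k - x - y) + (x + y)
  k≡[k-x-y]+[x+y] = solve-∀
  sum-of-squares : ∀ x y → (x * x + y * y) + + 0 ≡ (x + y) * (x + y) - + 2 * (x * y)
  sum-of-squares = solve-∀

n%6≡1⇒n%3≡1 : ∀ n → n % 6 ≡ 1 → n % 3 ≡ 1
n%6≡1⇒n%3≡1 n n%6≡1 = trans (sym (m∣n⇒o%n%m≡o%m 3 6 n (divides 2 refl))) (cong (_% 3) n%6≡1)

n²+n+1≡3[1+3q] : ∀ n → n % 3 ≡ 1 → ∃[ M ] n ℕ.* n ℕ.+ n ℕ.+ 1 ≡ 3 ℕ.* M × M % 3 ≡ 1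
n²+n+1≡3[1+3q] n n%3≡1 = 1 ℕ.+ (q ℕ.+ q ℕ.* q) ℕ.* 3 , order≡ , [m+kn]%n≡m%n 1 (q ℕ.+ q ℕ.* q) 3
  where
  q : ℕ
  q = n / 3
  n≡1+3q : n ≡ 1 ℕ.+ q ℕ.* 3
  n≡1+3q = trans (m≡m%n+[m/n]*n n 3) (cong (ℕ._+ q ℕ.* 3) n%3≡1)
  expand : ∀ q → let m = 1 ℕ.+ q ℕ.* 3 in m ℕ.* m ℕ.+ m ℕ.+ 1 ≡ 3 ℕ.* (1 ℕ.+ (q ℕ.+ q ℕ.* q) ℕ.* 3)
  expand = ℕ-Solver.solve-∀
  order≡ : n ℕ.* n ℕ.+ n ℕ.+ 1 ≡ 3 ℕ.* (1 ℕ.+ (q ℕ.+ q ℕ.* q) ℕ.* 3)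
  order≡ = trans (cong (λ m → m ℕ.* m ℕ.+ m ℕ.+ 1) n≡1+3q) (expand q)

¬Hyp-1 : ¬ Hyp 1
¬Hyp-1 (_ , inj₁ ())
¬Hyp-1 (_ , inj₂ (inj₁ (ℕ.s≤s () , _)))
¬Hyp-1 (_ , inj₂ (inj₂ (inj₁ (_ , ()))))
¬Hyp-1 (_ , inj₂ (inj₂ (inj₂ (inj₁ ()))))
¬Hyp-1 (_ , inj₂ (inj₂ (inj₂ (inj₂ (ℕ.s≤s () , _)))))

theorem7p5 : (n : ℕ) → n ≥ 1 → Hyp n →
    (G : FinAbGroup (n ℕ.* n ℕ.+ n ℕ.+ 1)) →
    ¬ (∃[ T₀ ] ∃[ T₁ ]
        (InverseClosed G T₀ × InverseClosed G T₁ × T₀ (FinAbGroup.ε G) ≡ true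
        × (∀ g → _⊛_ G (⟦_⟧ G T₀) (⟦_⟧ G T₁) g ≡ (𝟙H G ⊖ 𝟙e G) g)
        × (∀ g → (_⊛_ G (⟦_⟧ G T₀) (⟦_⟧ G T₀) ⊕ _⊛_ G (⟦_⟧ G T₁) (⟦_⟧ G T₁)) g
                 ≡ (((((+ 2) · 𝟙H G) ⊖ _⁽²⁾ G (⟦_⟧ G T₀)) ⊖ _⁽²⁾ G (⟦_⟧ G T₁))
                     ⊕ ((+ 2 * + n) · 𝟙e G)) g)))
theorem7p5 n _ hyp G (T₀ , T₁ , T₀-closed , T₁-closed , _ , product≡ , squares≡)
  with n²+n+1≡3[1+3q] n (n%6≡1⇒n%3≡1 n (proj₁ hyp))
... | M , N≡3M , M%3≡1 = ¬Hyp-1 (subst Hyp n≡1 hyp)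
  where
  open CubicCharacter (FinAbGroupProperties.epimorphismToℤ₃ G M N≡3M M%3≡1)

  T₀-sym : Symmetric (⟦_⟧ G T₀)
  T₀-sym g = cong χ (T₀-closed g)

  T₁-sym : Symmetric (⟦_⟧ G T₁)
  T₁-sym g = cong χ (T₁-closed g)

  2n≡2 : + 2 * + n ≡ + 2
  2n≡2 = x*y≡-1∧x²+y²≡k-x-y⇒k≡2 (D-product-equation T₀-sym T₁-sym product≡)
                                 (D-squares-equation T₀-sym T₁-sym (+ 2 * + n) squares≡)

  n≡1 : n ≡ 1
  n≡1 = ℕP.*-cancelˡ-≡ n 1 2 (ℤP.+-injective (trans (ℤP.pos-* 2 n) 2n≡2))
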